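{- In shortened selective compound Node-Kayles under normal play, the set $\mathcal{L}$ of integers $m\ge 0$ such that the single path $P_m$ is a $\mathcal{P}$-position is $$\mathcal{L}=\{5n:\ n\ge 0\}\cup\{5n+4:\ n\ge 0\}.$$
   Context: For $n\ge 0$, $P_n$ denotes the path on $n$ vertices ($P_0$ is the empty graph). A Node-Kayles move on a path $P_k$ with $k\ge 1$ chooses a vertex and deletes it together with its neighbours. The possible results are: $P_0$ if $k\in\{1,2\}$; $P_0$ or $P_1$ if $k=3$; and, for $k\ge 4$, $P_{k-2}$, $P_{k-3}$, or two paths $P_i,P_j$ with $j\ge i\ge1$, $i+j=k-3$. Shortened selective compound Node-Kayles is played by two players who move alternately, starting from a single path. A position is a finite multiset of paths (components). A move consists in choosing any nonempty set of nonempty components and replacing each chosen component by the result of a Node-Kayles move on it; a split component yields two components. The game ends as soon as some component is the empty path $P_0$ (short ending rule). Under normal play, the player who made the last move wins. A position is a $\mathcal{P}$-position if the second player (the one not moving next) has a winning strategy, and an $\mathcal{N}$-position otherwise. In particular, $P_0$ is a $\mathcal{P}$-position. -}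

module Defs where

open import Data.Nat using (ℕ; zero; suc; _+_; _≤_)
open import Data.List using (List; []; _∷_; [_]; _++_)
open import Data.List.Membership.Propositional using (_∈_)
open import Relation.Binary.PropositionalEquality using (_≡_)
open import Relation.Nullary using (¬_)

-- A position is a finite multiset of paths, represented as a list of path
-- lengths (the number m stands for the path P_m).

-- NK k r : r is the list of components resulting from a Node-Kayles move
-- on the path P_k (k ≥ 1).  Cases follow the paper exactly.
data NK : ℕ → List ℕ → Set where
  nk-1   : NK 1 [ 0 ]
  nk-2   : NK 2 [ 0 ]
  nk-3a  : NK 3 [ 0 ]
  nk-3b  : NK 3 [ 1 ]
  nk-minus2 : ∀ m → NK (suc (suc (suc (suc m)))) [ suc (suc m) ]
  nk-minus3 : ∀ m → NK (suc (suc (suc (suc m)))) [ suc m ]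
  nk-split  : ∀ m i j → 1 ≤ i → i ≤ j → i + j ≡ suc m →
              NK (suc (suc (suc (suc m)))) (i ∷ j ∷ [])

data Sel : List ℕ → List ℕ → Set where
  sel-[]     : Sel [] []
  sel-keep   : ∀ {k ks rs} → Sel ks rs → Sel (k ∷ ks) (k ∷ rs)
  sel-change : ∀ {k r ks rs} → NK k r → Sel ks rs → Sel (k ∷ ks) (r ++ rs)

-- Move ps qs : a selective compound move, i.e. a nonempty set of components
-- is chosen and each chosen one is replaced by the result of a Node-Kayles move.
-- (The constructor records the first chosen component.)
data Move : List ℕ → List ℕ → Set where
  mv-here  : ∀ {k r ks rs} → NK k r → Sel ks rs → Move (k ∷ ks) (r ++ rs)
  mv-there : ∀ {k ks rs} → Move ks rs → Move (k ∷ ks) (k ∷ rs)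

-- Short ending rule: the game is over as soon as some component is P_0.
Ended : List ℕ → Set
Ended ps = 0 ∈ ps

-- Outcome classes under normal play (the game is finite, so these inductive
-- definitions coincide with existence of winning strategies).
data IsP : List ℕ → Set
data IsN : List ℕ → Set

data IsP where
  P-ended : ∀ {ps} → Ended ps → IsP ps
  P-all   : ∀ {ps} → ¬ Ended ps → (∀ qs → Move ps qs → IsN qs) → IsP ps

data IsN where
  N-win : ∀ {ps} qs → ¬ Ended ps → Move ps qs → IsP qs → IsN ps

InL : ℕ → Set
InL m = IsP [ m ]

-- A position all of whose components are nonempty is a P-position exactly
-- when every component is "cold", i.e. has length ≡ 0 or 4 (mod 5).  Every
-- move on a cold path leaves nonempty paths not all of which are cold, while
-- on a hot path some move yields P_0 or a cold path.  Because a selective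
-- move may touch any nonempty set of components, from a position with a hot
-- component the mover cools all hot components at once; from an all-cold
-- position every move heats some component.
module Submission where

open import Defs
open import Data.Nat using (ℕ; zero; suc; _+_; _*_; _<_; _≤_; z≤n; s≤s; z<s; NonZero; >-nonZero; ≢-nonZero⁻¹)
open import Data.Nat.Properties using (nonZero?; m<n+m; +-identityʳ; ≤-trans; <⇒≤; +-mono-≤; +-monoʳ-≤; +-mono-<-≤; +-monoʳ-<; *-suc)
open import Data.Nat.Induction using (<-wellFounded)
open import Data.Bool using (Bool; true; false; T)
open import Data.Product using (∃-syntax; _×_; _,_; proj₁)
open import Data.Sum using (_⊎_; inj₁; inj₂)
open import Data.List using (List; []; _∷_; [_]; _++_)
open import Data.Nat.ListAction using (sum)
open import Data.Nat.ListAction.Properties using (sum-++)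
open import Data.List.Membership.Propositional using (_∈_)
open import Data.List.Membership.Propositional.Properties using (∈-++⁺ˡ; ∈-++⁺ʳ)
open import Data.List.Relation.Unary.All using (All; []; _∷_; map; lookup; all?)
open import Data.List.Relation.Unary.All.Properties using (++⁺; ++⁻ˡ)
open import Data.List.Relation.Unary.Any using (here; there)
open import Data.Empty using (⊥-elim)
open import Function.Bundles using (_⇔_; mk⇔)
open import Function.Properties.Equivalence using () renaming (trans to ⇔-trans)
open import Induction.WellFounded using (Acc; acc)
open import Relation.Nullary using (¬_; yes; no)
open import Relation.Nullary.Decidable using (T?; _×-dec_)
open import Relation.Unary using (Decidable)
open import Relation.Binary.PropositionalEquality using (_≡_; refl; sym; cong; subst)

NK-shrinks : ∀ {k r} → NK k r → sum r < k
NK-shrinks nk-1 = z<s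
NK-shrinks nk-2 = z<s
NK-shrinks nk-3a = z<s
NK-shrinks nk-3b = s≤s z<s
NK-shrinks (nk-minus2 m) rewrite +-identityʳ (2 + m) = m<n+m (2 + m) {2} z<s
NK-shrinks (nk-minus3 m) rewrite +-identityʳ (1 + m) = m<n+m (1 + m) {3} z<s
NK-shrinks (nk-split m i j _ _ i+j≡1+m) rewrite +-identityʳ j | i+j≡1+m = m<n+m (1 + m) {3} z<s

Sel-nonincreasing : ∀ {ps qs} → Sel ps qs → sum qs ≤ sum ps
Sel-nonincreasing sel-[] = z≤n
Sel-nonincreasing (sel-keep {k} s) = +-monoʳ-≤ k (Sel-nonincreasing s)
Sel-nonincreasing (sel-change {r = r} {rs = rs} nk s) rewrite sum-++ r rs =
  +-mono-≤ (<⇒≤ (NK-shrinks nk)) (Sel-nonincreasing s)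

Move-shrinks : ∀ {ps qs} → Move ps qs → sum qs < sum ps
Move-shrinks (mv-here {r = r} {rs = rs} nk s) rewrite sum-++ r rs =
  +-mono-<-≤ (NK-shrinks nk) (Sel-nonincreasing s)
Move-shrinks (mv-there {k} mv) = +-monoʳ-< k (Move-shrinks mv)

¬Ended : ∀ {ps} → All NonZero ps → ¬ Ended ps
¬Ended nonZero 0∈ps = ≢-nonZero⁻¹ 0 {{lookup nonZero 0∈ps}} refl

IsP⇒¬IsN : ∀ {ps} → IsP ps → ¬ IsN ps
IsP⇒¬IsN (P-ended ended) (N-win _ ¬ended _ _) = ¬ended ended
IsP⇒¬IsN (P-all _ allN) (N-win qs _ mv isP) = IsP⇒¬IsN isP (allN qs mv)

module SelectiveCompound
  {Cold : ℕ → Set}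
  (cold? : Decidable Cold)
  (cold⇒nonZero : ∀ {k} → Cold k → NonZero k)
  (NK-from-cold : ∀ {k r} → Cold k → NK k r → All NonZero r × ¬ All Cold r)
  (NK-to-cold : ∀ {k} → NonZero k → ¬ Cold k → ∃[ r ] NK k r × (0 ∈ r ⊎ All Cold r))
  where

  Cooled : List ℕ → Set
  Cooled qs = 0 ∈ qs ⊎ All Cold qs

  Cooled-++ : ∀ r {rs} → Cooled r → Cooled rs → Cooled (r ++ rs)
  Cooled-++ r (inj₁ 0∈r) _ = inj₁ (∈-++⁺ˡ 0∈r)
  Cooled-++ r (inj₂ _) (inj₁ 0∈rs) = inj₁ (∈-++⁺ʳ r 0∈rs)
  Cooled-++ r (inj₂ cold-r) (inj₂ cold-rs) = inj₂ (++⁺ cold-r cold-rs)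

  Cooled-∷ : ∀ {k rs} → Cold k → Cooled rs → Cooled (k ∷ rs)
  Cooled-∷ _ (inj₁ 0∈rs) = inj₁ (there 0∈rs)
  Cooled-∷ cold-k (inj₂ cold-rs) = inj₂ (cold-k ∷ cold-rs)

  Sel-from-cold : ∀ {ps qs} → All Cold ps → Sel ps qs → All NonZero qs
  Sel-from-cold [] sel-[] = []
  Sel-from-cold (cold-k ∷ cold) (sel-keep s) = cold⇒nonZero cold-k ∷ Sel-from-cold cold s
  Sel-from-cold (cold-k ∷ cold) (sel-change nk s) =
    ++⁺ (proj₁ (NK-from-cold cold-k nk)) (Sel-from-cold cold s)

  Move-from-cold : ∀ {ps qs} → All Cold ps → Move ps qs → All NonZero qs × ¬ All Cold qs
  Move-from-cold (cold-k ∷ cold) (mv-here {r = r} nk s) with NK-from-cold cold-k nk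
  ... | nonZero-r , ¬cold-r =
    ++⁺ nonZero-r (Sel-from-cold cold s) , λ cold-qs → ¬cold-r (++⁻ˡ r cold-qs)
  Move-from-cold (cold-k ∷ cold) (mv-there mv) with Move-from-cold cold mv
  ... | nonZero-qs , ¬cold-qs =
    cold⇒nonZero cold-k ∷ nonZero-qs , λ { (_ ∷ cold-qs) → ¬cold-qs cold-qs }

  Sel-to-cold : ∀ {ps} → All NonZero ps → ∃[ qs ] Sel ps qs × Cooled qs
  Sel-to-cold [] = [] , sel-[] , inj₂ []
  Sel-to-cold {k ∷ _} (nonZero-k ∷ nonZero) with Sel-to-cold nonZero | cold? k
  ... | qs , s , cooled | yes cold-k = k ∷ qs , sel-keep s , Cooled-∷ cold-k cooled
  ... | qs , s , cooled | no ¬cold-k with NK-to-cold nonZero-k ¬cold-k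
  ...   | r , nk , cooled-r = r ++ qs , sel-change nk s , Cooled-++ r cooled-r cooled

  Move-to-cold : ∀ {ps} → All NonZero ps → ¬ All Cold ps → ∃[ qs ] Move ps qs × Cooled qs
  Move-to-cold [] ¬cold = ⊥-elim (¬cold [])
  Move-to-cold {k ∷ _} (nonZero-k ∷ nonZero) ¬cold with cold? k
  ... | yes cold-k with Move-to-cold nonZero (λ cold-ks → ¬cold (cold-k ∷ cold-ks))
  ...   | qs , mv , cooled = k ∷ qs , mv-there mv , Cooled-∷ cold-k cooled
  Move-to-cold {k ∷ _} (nonZero-k ∷ nonZero) ¬cold | no ¬cold-k
    with NK-to-cold nonZero-k ¬cold-k | Sel-to-cold nonZero
  ... | r , nk , cooled-r | qs , s , cooled = r ++ qs , mv-here nk s , Cooled-++ r cooled-r cooled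

  cold⇒IsP : ∀ {ps} → Acc _<_ (sum ps) → All Cold ps → IsP ps
  hot⇒IsN : ∀ {ps} → Acc _<_ (sum ps) → All NonZero ps → ¬ All Cold ps → IsN ps

  cold⇒IsP (acc smaller) cold =
    P-all (¬Ended (map cold⇒nonZero cold)) λ qs mv →
      let nonZero-qs , ¬cold-qs = Move-from-cold cold mv
      in hot⇒IsN (smaller (Move-shrinks mv)) nonZero-qs ¬cold-qs

  hot⇒IsN (acc smaller) nonZero ¬cold with Move-to-cold nonZero ¬cold
  ... | qs , mv , inj₁ 0∈qs = N-win qs (¬Ended nonZero) mv (P-ended 0∈qs)
  ... | qs , mv , inj₂ cold-qs =
    N-win qs (¬Ended nonZero) mv (cold⇒IsP (smaller (Move-shrinks mv)) cold-qs)

  IsP⇔All-Cold : ∀ {ps} → All NonZero ps → IsP ps ⇔ All Cold ps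
  IsP⇔All-Cold {ps} nonZero = mk⇔ to (cold⇒IsP (<-wellFounded (sum ps)))
    where
    to : IsP ps → All Cold ps
    to isP with all? cold? ps
    ... | yes cold = cold
    ... | no ¬cold = ⊥-elim (IsP⇒¬IsN isP (hot⇒IsN (<-wellFounded (sum ps)) nonZero ¬cold))

isZeroOrFourMod5 : ℕ → Bool
isZeroOrFourMod5 0 = true
isZeroOrFourMod5 1 = false
isZeroOrFourMod5 2 = false
isZeroOrFourMod5 3 = false
isZeroOrFourMod5 4 = true
isZeroOrFourMod5 (suc (suc (suc (suc (suc n))))) = isZeroOrFourMod5 n

ZeroOrFourMod5 : ℕ → Set
ZeroOrFourMod5 m = T (isZeroOrFourMod5 m)

ZeroOrFourMod5-4+⇒¬2+ : ∀ m → ZeroOrFourMod5 (4 + m) → ¬ ZeroOrFourMod5 (2 + m)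
ZeroOrFourMod5-4+⇒¬2+ 0 _ ()
ZeroOrFourMod5-4+⇒¬2+ 1 _ ()
ZeroOrFourMod5-4+⇒¬2+ (suc (suc (suc (suc (suc m))))) = ZeroOrFourMod5-4+⇒¬2+ m

ZeroOrFourMod5-4+⇒¬1+ : ∀ m → ZeroOrFourMod5 (4 + m) → ¬ ZeroOrFourMod5 (1 + m)
ZeroOrFourMod5-4+⇒¬1+ 0 _ ()
ZeroOrFourMod5-4+⇒¬1+ 1 _ ()
ZeroOrFourMod5-4+⇒¬1+ (suc (suc (suc (suc (suc m))))) = ZeroOrFourMod5-4+⇒¬1+ m

ZeroOrFourMod5-¬4+⇒2+⊎1+ : ∀ m → ¬ ZeroOrFourMod5 (4 + m) →
                           ZeroOrFourMod5 (2 + m) ⊎ ZeroOrFourMod5 (1 + m)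
ZeroOrFourMod5-¬4+⇒2+⊎1+ 0 ¬z = ⊥-elim (¬z _)
ZeroOrFourMod5-¬4+⇒2+⊎1+ 1 ¬z = ⊥-elim (¬z _)
ZeroOrFourMod5-¬4+⇒2+⊎1+ 2 _ = inj₁ _
ZeroOrFourMod5-¬4+⇒2+⊎1+ 3 _ = inj₂ _
ZeroOrFourMod5-¬4+⇒2+⊎1+ 4 _ = inj₂ _
ZeroOrFourMod5-¬4+⇒2+⊎1+ (suc (suc (suc (suc (suc m))))) = ZeroOrFourMod5-¬4+⇒2+⊎1+ m

ZeroOrFourMod5-¬3+sum : ∀ i j → ZeroOrFourMod5 i → ZeroOrFourMod5 j →
                        ¬ ZeroOrFourMod5 (3 + (i + j))
ZeroOrFourMod5-¬3+sum 0 j _ = ¬3+ j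
  where
  ¬3+ : ∀ j → ZeroOrFourMod5 j → ¬ ZeroOrFourMod5 (3 + j)
  ¬3+ 0 _ ()
  ¬3+ 4 _ ()
  ¬3+ (suc (suc (suc (suc (suc j))))) = ¬3+ j
ZeroOrFourMod5-¬3+sum 4 j _ = ¬7+ j
  where
  ¬7+ : ∀ j → ZeroOrFourMod5 j → ¬ ZeroOrFourMod5 (7 + j)
  ¬7+ 0 _ ()
  ¬7+ 4 _ ()
  ¬7+ (suc (suc (suc (suc (suc j))))) = ¬7+ j
ZeroOrFourMod5-¬3+sum (suc (suc (suc (suc (suc i))))) j = ZeroOrFourMod5-¬3+sum i j

ZeroOrFourMod5⇔∃ : ∀ m → ZeroOrFourMod5 m ⇔ (∃[ n ] (m ≡ 5 * n ⊎ m ≡ 5 * n + 4))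
ZeroOrFourMod5⇔∃ m = mk⇔ (to m) from
  where
  shift : ∀ {k} → ∃[ n ] (k ≡ 5 * n ⊎ k ≡ 5 * n + 4) → ∃[ n ] (5 + k ≡ 5 * n ⊎ 5 + k ≡ 5 * n + 4)
  shift (n , inj₁ refl) = suc n , inj₁ (sym (*-suc 5 n))
  shift (n , inj₂ refl) = suc n , inj₂ (cong (_+ 4) (sym (*-suc 5 n)))
  to : ∀ k → ZeroOrFourMod5 k → ∃[ n ] (k ≡ 5 * n ⊎ k ≡ 5 * n + 4)
  to 0 _ = 0 , inj₁ refl
  to 4 _ = 0 , inj₂ refl
  to (suc (suc (suc (suc (suc k))))) z = shift (to k z)
  5* : ∀ n → ZeroOrFourMod5 (5 * n)
  5* zero = _
  5* (suc n) = subst ZeroOrFourMod5 (sym (*-suc 5 n)) (5* n)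
  5*+4 : ∀ n → ZeroOrFourMod5 (5 * n + 4)
  5*+4 zero = _
  5*+4 (suc n) = subst (λ x → ZeroOrFourMod5 (x + 4)) (sym (*-suc 5 n)) (5*+4 n)
  from : ∃[ n ] (m ≡ 5 * n ⊎ m ≡ 5 * n + 4) → ZeroOrFourMod5 m
  from (n , inj₁ refl) = 5* n
  from (n , inj₂ refl) = 5*+4 n

Cold : ℕ → Set
Cold k = NonZero k × ZeroOrFourMod5 k

NK-from-cold : ∀ {k r} → Cold k → NK k r → All NonZero r × ¬ All Cold r
NK-from-cold (_ , z) (nk-minus2 m) = _ ∷ [] , λ { ((_ , z′) ∷ []) → ZeroOrFourMod5-4+⇒¬2+ m z z′ }
NK-from-cold (_ , z) (nk-minus3 m) = _ ∷ [] , λ { ((_ , z′) ∷ []) → ZeroOrFourMod5-4+⇒¬1+ m z z′ }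
NK-from-cold (_ , z) (nk-split m i j 1≤i i≤j i+j≡1+m) =
  >-nonZero 1≤i ∷ >-nonZero (≤-trans 1≤i i≤j) ∷ [] ,
  λ { ((_ , zi) ∷ (_ , zj) ∷ []) →
      ZeroOrFourMod5-¬3+sum i j zi zj (subst (λ x → ZeroOrFourMod5 (3 + x)) (sym i+j≡1+m) z) }

NK-to-cold : ∀ {k} → NonZero k → ¬ Cold k → ∃[ r ] NK k r × (0 ∈ r ⊎ All Cold r)
-- No clause for k = 0: NonZero 0 is a record with an empty field, so Agda sees it is uninhabited.
NK-to-cold {1} _ _ = [ 0 ] , nk-1 , inj₁ (here refl)
NK-to-cold {2} _ _ = [ 0 ] , nk-2 , inj₁ (here refl)
NK-to-cold {3} _ _ = [ 0 ] , nk-3a , inj₁ (here refl)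
NK-to-cold {suc (suc (suc (suc m)))} _ ¬cold with ZeroOrFourMod5-¬4+⇒2+⊎1+ m (λ z → ¬cold (_ , z))
... | inj₁ z = _ , nk-minus2 m , inj₂ ((_ , z) ∷ [])
... | inj₂ z = _ , nk-minus3 m , inj₂ ((_ , z) ∷ [])

open SelectiveCompound {Cold} (λ k → nonZero? k ×-dec T? (isZeroOrFourMod5 k)) proj₁ NK-from-cold NK-to-cold

corollary8 : ∀ (m : ℕ) →
    InL m ⇔ (∃[ n ] (m ≡ 5 * n ⊎ m ≡ 5 * n + 4))
corollary8 zero = mk⇔ (λ _ → 0 , inj₁ refl) (λ _ → P-ended (here refl))
corollary8 (suc m) =
  ⇔-trans (IsP⇔All-Cold (_ ∷ [])) (⇔-trans All-Cold-singleton (ZeroOrFourMod5⇔∃ (suc m)))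
  where
  All-Cold-singleton : All Cold [ suc m ] ⇔ ZeroOrFourMod5 (suc m)
  All-Cold-singleton = mk⇔ (λ { ((_ , z) ∷ []) → z }) (λ z → (_ , z) ∷ [])
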